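{- Let $\mathcal{T}=(\mathit{res},\mathit{clm},\mathit{pos},\mathit{spd},\mathit{acc})$ be a traffic snapshot, i.e. a tuple of functions satisfying the sanity conditions (1)–(6) below. Then every structure $\mathcal{T}'$ such that $\mathcal{T}\xrightarrow{\alpha}\mathcal{T}'$ for one of the transition kinds $\alpha$ listed below is again a traffic snapshot satisfying the sanity conditions (1)–(6).
   Context: Fix a countably infinite set $\mathbb{I}$ of car identifiers and a set of lanes $\mathbb{L}=\{0,\dots,N\}$ with $N\ge 1$. For a function $f$, $f\oplus\{x\mapsto y\}$ denotes the function equal to $y$ at $x$ and to $f(z)$ at every $z\neq x$. A traffic snapshot is a tuple $\mathcal{T}=(\mathit{res},\mathit{clm},\mathit{pos},\mathit{spd},\mathit{acc})$ of functions $\mathit{res},\mathit{clm}:\mathbb{I}\to\mathcal{P}(\mathbb{L})$ (reserved and claimed lanes of each car) and $\mathit{pos},\mathit{spd},\mathit{acc}:\mathbb{I}\to\mathbb{R}$ such that for all $C\in\mathbb{I}$: (1) $\mathit{res}(C)\cap\mathit{clm}(C)=\emptyset$; (2) $1\le|\mathit{res}(C)|\le 2$; (3) $0\le|\mathit{clm}(C)|\le 1$; (4) $1\le|\mathit{res}(C)|+|\mathit{clm}(C)|\le 2$; (5) if $\mathit{clm}(C)\neq\emptyset$ then there is $n\in\mathbb{L}$ with $\mathit{res}(C)\cup\mathit{clm}(C)=\{n,n+1\}$; (6) $|\mathit{res}(C)|=2$ or $|\mathit{clm}(C)|=1$ holds only for finitely many $C\in\mathbb{I}$. Transitions (for $C\in\mathbb{I}$,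 $n\in\mathbb{L}$, $t,a\in\mathbb{R}$): - Claim: $\mathcal{T}\xrightarrow{c(C,n)}\mathcal{T}'$ iff $\mathcal{T}'=(\mathit{res},\mathit{clm}',\mathit{pos},\mathit{spd},\mathit{acc})$, $|\mathit{clm}(C)|=0$, $|\mathit{res}(C)|=1$, $\mathit{res}(C)\cap\{n+1,n-1\}\neq\emptyset$ and $\mathit{clm}'=\mathit{clm}\oplus\{C\mapsto\{n\}\}$. - Withdraw claim: $\mathcal{T}\xrightarrow{wd\,c(C)}\mathcal{T}'$ iff $\mathcal{T}'=(\mathit{res},\mathit{clm}',\mathit{pos},\mathit{spd},\mathit{acc})$ with $\mathit{clm}'=\mathit{clm}\oplus\{C\mapsto\emptyset\}$. - Reservation: $\mathcal{T}\xrightarrow{r(C)}\mathcal{T}'$ iff $\mathcal{T}'=(\mathit{res}',\mathit{clm}',\mathit{pos},\mathit{spd},\mathit{acc})$ with $\mathit{clm}'=\mathit{clm}\oplus\{C\mapsto\emptyset\}$ and $\mathit{res}'=\mathit{res}\oplus\{C\mapsto\mathit{res}(C)\cup\mathit{clm}(C)\}$. - Withdraw reservation: $\mathcal{T}\xrightarrow{wd\,r(C,n)}\mathcal{T}'$ iff $\mathcal{T}'=(\mathit{res}',\mathit{clm},\mathit{pos},\mathit{spd},\mathit{acc})$ with $\mathit{res}'=\mathit{res}\oplus\{C\mapsto\{n\}\}$, $n\in\mathit{res}(C)$ and $|\mathit{res}(C)|=2$. - Passing of time: $\mathcal{T}\xrightarrow{t}\mathcal{T}'$ iff $\mathcal{T}'=(\mathit{res},\mathit{clm},\mathit{pos}',\mathit{spd}',\mathit{acc})$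 with $\mathit{pos}'(C)=\mathit{pos}(C)+\mathit{spd}(C)t+\tfrac12\mathit{acc}(C)t^2$ and $\mathit{spd}'(C)=\mathit{spd}(C)+\mathit{acc}(C)t$ for all $C\in\mathbb{I}$. - Acceleration: $\mathcal{T}\xrightarrow{acc(C,a)}\mathcal{T}'$ iff $\mathcal{T}'=(\mathit{res},\mathit{clm},\mathit{pos},\mathit{spd},\mathit{acc}')$ with $\mathit{acc}'=\mathit{acc}\oplus\{C\mapsto a\}$. -}

module Defs where

open import Data.Nat using (ℕ; zero; suc; _+_; _≤_; _≟_)
open import Data.Fin using (Fin; toℕ)
open import Data.Fin.Subset using (Subset; _∩_; _∪_; ∣_∣; ⁅_⁆; ⊥)
open import Data.Vec using (tabulate)
open import Data.Bool using (Bool; _∨_; if_then_else_)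
open import Data.List using (List)
open import Data.List.Membership.Propositional using () renaming (_∈_ to _∈ₗ_)
open import Data.Product using (_×_; ∃; ∃-syntax; Σ-syntax)
open import Data.Sum using (_⊎_)
open import Relation.Nullary using (¬_; does)
open import Relation.Binary.PropositionalEquality using (_≡_)

-- Lanes 𝕃 = {0,…,N} are Fin (suc N); sets of lanes are Subset (suc N).
-- Car identifiers 𝕀 are ℕ (a countably infinite set).
Car : Set
Car = ℕ

Lane : ℕ → Set
Lane N = Fin (suc N)

Lanes : ℕ → Set
Lanes N = Subset (suc N)

-- A structure (res, clm, pos, spd, acc); R plays the role of ℝ.
record Structure (N : ℕ) (R : Set) : Set where
  constructor mk
  field
    res clm : Car → Lanes N
    pos spd acc : Car → R
open Structure public

_⊕[_↦_] : {A : Set} → (Car → A) → Car → A → Car → A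
(f ⊕[ x ↦ y ]) z = if does (z ≟ x) then y else f z

_≗_ : {A : Set} → (Car → A) → (Car → A) → Set
f ≗ g = ∀ C → f C ≡ g C

adj : {N : ℕ} → Lane N → Lanes N
adj n = tabulate λ l → does (toℕ l ≟ suc (toℕ n)) ∨ does (toℕ n ≟ suc (toℕ l))

record Sane {N : ℕ} {R : Set} (T : Structure N R) : Set where
  field
    s1 : ∀ C → res T C ∩ clm T C ≡ ⊥
    s2 : ∀ C → 1 ≤ ∣ res T C ∣ × ∣ res T C ∣ ≤ 2
    s3 : ∀ C → ∣ clm T C ∣ ≤ 1
    s4 : ∀ C → 1 ≤ ∣ res T C ∣ + ∣ clm T C ∣ × ∣ res T C ∣ + ∣ clm T C ∣ ≤ 2
    s5 : ∀ C → ¬ (clm T C ≡ ⊥) →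
           ∃[ n ] ∃[ m ] (toℕ m ≡ suc (toℕ n) × res T C ∪ clm T C ≡ ⁅ n ⁆ ∪ ⁅ m ⁆)
    s6 : ∃[ L ] (∀ C → (∣ res T C ∣ ≡ 2 ⊎ ∣ clm T C ∣ ≡ 1) → C ∈ₗ L)

data Action (N : ℕ) (R : Set) : Set where
  c    : Car → Lane N → Action N R
  wdc  : Car → Action N R
  r    : Car → Action N R
  wdr  : Car → Lane N → Action N R
  time : R → Action N R
  accl : Car → R → Action N R

-- transition relation T --α--> T'; the real-number operations are parameters
-- (_+ᴿ_, _*ᴿ_, half = 1/2).
Step : {N : ℕ} {R : Set} (_+ᴿ_ _*ᴿ_ : R → R → R) (half : R) →
       Structure N R → Action N R → Structure N R → Set
Step _ _ _ T (c C n) T' =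
  res T' ≗ res T × pos T' ≗ pos T × spd T' ≗ spd T × acc T' ≗ acc T ×
  ∣ clm T C ∣ ≡ 0 × ∣ res T C ∣ ≡ 1 × ¬ (res T C ∩ adj n ≡ ⊥) ×
  clm T' ≗ (clm T ⊕[ C ↦ ⁅ n ⁆ ])
Step _ _ _ T (wdc C) T' =
  res T' ≗ res T × pos T' ≗ pos T × spd T' ≗ spd T × acc T' ≗ acc T ×
  clm T' ≗ (clm T ⊕[ C ↦ ⊥ ])
Step _ _ _ T (r C) T' =
  pos T' ≗ pos T × spd T' ≗ spd T × acc T' ≗ acc T ×
  clm T' ≗ (clm T ⊕[ C ↦ ⊥ ]) ×
  res T' ≗ (res T ⊕[ C ↦ res T C ∪ clm T C ])
Step _ _ _ T (wdr C n) T' =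
  clm T' ≗ clm T × pos T' ≗ pos T × spd T' ≗ spd T × acc T' ≗ acc T ×
  res T' ≗ (res T ⊕[ C ↦ ⁅ n ⁆ ]) ×
  (n Data.Fin.Subset.∈ res T C) × ∣ res T C ∣ ≡ 2
Step _+ᴿ_ _*ᴿ_ half T (time t) T' =
  res T' ≗ res T × clm T' ≗ clm T × acc T' ≗ acc T ×
  (∀ C → pos T' C ≡ (pos T C +ᴿ (spd T C *ᴿ t)) +ᴿ ((half *ᴿ acc T C) *ᴿ (t *ᴿ t))) ×
  (∀ C → spd T' C ≡ spd T C +ᴿ (acc T C *ᴿ t))
Step _ _ _ T (accl C a) T' =
  res T' ≗ res T × clm T' ≗ clm T × pos T' ≗ pos T × spd T' ≗ spd T ×
  acc T' ≗ (acc T ⊕[ C ↦ a ])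

-- Every transition either leaves res and clm untouched, or overrides them at a single
-- car C; the other cars keep their sanity conditions (1)-(5), and C, adjoined to the
-- finite list witnessing (6), covers the only car whose status may have changed. At C,
-- (1)-(5) are checked directly: a claim adds a lane adjacent to a single reserved one;
-- a reservation merges disjoint res and clm into one or two consecutive lanes with no
-- claim; withdrawing a claim or a reservation leaves one or two reserved lanes and no
-- claim, the latter because |res C| = 2 forces clm C = ∅ by (4).
module Submission where

open import Defs
open import Data.Nat using (ℕ; suc; _+_; _≤_; z≤n; s≤s; _≟_)
open import Data.Nat.Properties using (1+n≢n; +-suc; +-identityʳ; suc-injective; +-cancelˡ-≤; n≤0⇒n≡0)
open import Data.Fin using (Fin; toℕ) renaming (zero to fzero; suc to fsuc)
open import Data.Fin.Subset using (Subset; _∈_; _∩_; _∪_; ∣_∣; ⁅_⁆; ⊥; inside; outside)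
open import Data.Fin.Subset.Properties
  using (Empty-unique; ∩-zeroʳ; ∪-comm; ∣⁅x⁆∣≡1; ∣⊥∣≡0; x∈p∩q⁻; x∈⁅y⁆⇒x≡y)
open import Data.Vec using ([]; _∷_; tail)
open import Data.Vec.Properties using (lookup∘tabulate; []=⇒lookup)
open import Data.Bool using (true; _∨_; if_then_else_)
open import Data.List using (_∷_)
open import Data.List.Membership.Propositional using () renaming (_∈_ to _∈ₗ_)
open import Data.List.Relation.Unary.Any using (here; there)
open import Data.Product using (_×_; _,_; ∃-syntax; proj₁; proj₂)
open import Data.Sum using (_⊎_; inj₁; inj₂)
open import Relation.Nullary using (¬_; does; yes; no; contradiction)
open import Relation.Nullary.Decidable using (Dec; _⊎-dec_; dec-true; dec-false)
open import Relation.Binary.PropositionalEquality using (_≡_; _≢_; refl; sym; trans; cong; cong₂; subst; subst₂)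

private
  variable
    N : ℕ
    n : ℕ
    R : Set

1≤_≤2 : ℕ → Set
1≤ k ≤2 = 1 ≤ k × k ≤ 2

∣p∣≡0⇒p≡⊥ : (p : Subset n) → ∣ p ∣ ≡ 0 → p ≡ ⊥
∣p∣≡0⇒p≡⊥ []            _    = refl
∣p∣≡0⇒p≡⊥ (inside ∷ p)  ()
∣p∣≡0⇒p≡⊥ (outside ∷ p) ∣p∣≡0 = cong (outside ∷_) (∣p∣≡0⇒p≡⊥ p ∣p∣≡0)

∣p∣≡1⇒p≡⁅x⁆ : (p : Subset n) → ∣ p ∣ ≡ 1 → ∃[ x ] p ≡ ⁅ x ⁆
∣p∣≡1⇒p≡⁅x⁆ [] ()
∣p∣≡1⇒p≡⁅x⁆ (inside ∷ p) ∣p∣≡1 =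
  fzero , cong (inside ∷_) (∣p∣≡0⇒p≡⊥ p (suc-injective ∣p∣≡1))
∣p∣≡1⇒p≡⁅x⁆ (outside ∷ p) ∣p∣≡1 with ∣p∣≡1⇒p≡⁅x⁆ p ∣p∣≡1
... | x , p≡⁅x⁆ = fsuc x , cong (outside ∷_) p≡⁅x⁆

p∩q≡⊥⇒∣p∪q∣≡∣p∣+∣q∣ : (p q : Subset n) → p ∩ q ≡ ⊥ → ∣ p ∪ q ∣ ≡ ∣ p ∣ + ∣ q ∣
p∩q≡⊥⇒∣p∪q∣≡∣p∣+∣q∣ [] [] _ = refl
p∩q≡⊥⇒∣p∪q∣≡∣p∣+∣q∣ (inside ∷ p) (inside ∷ q) ()
p∩q≡⊥⇒∣p∪q∣≡∣p∣+∣q∣ (inside ∷ p) (outside ∷ q) eq =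
  cong suc (p∩q≡⊥⇒∣p∪q∣≡∣p∣+∣q∣ p q (cong tail eq))
p∩q≡⊥⇒∣p∪q∣≡∣p∣+∣q∣ (outside ∷ p) (inside ∷ q) eq =
  trans (cong suc (p∩q≡⊥⇒∣p∪q∣≡∣p∣+∣q∣ p q (cong tail eq))) (sym (+-suc ∣ p ∣ ∣ q ∣))
p∩q≡⊥⇒∣p∪q∣≡∣p∣+∣q∣ (outside ∷ p) (outside ∷ q) eq =
  p∩q≡⊥⇒∣p∪q∣≡∣p∣+∣q∣ p q (cong tail eq)

⁅x⁆∩⁅y⁆≡⊥ : {x y : Fin n} → x ≢ y → ⁅ x ⁆ ∩ ⁅ y ⁆ ≡ ⊥
⁅x⁆∩⁅y⁆≡⊥ {x = x} {y} x≢y = Empty-unique λ (z , z∈⁅x⁆∩⁅y⁆) →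
  let z∈⁅x⁆ , z∈⁅y⁆ = x∈p∩q⁻ ⁅ x ⁆ ⁅ y ⁆ z∈⁅x⁆∩⁅y⁆
  in x≢y (trans (sym (x∈⁅y⁆⇒x≡y x z∈⁅x⁆)) (x∈⁅y⁆⇒x≡y y z∈⁅y⁆))

Adjacent : Lane N → Lane N → Set
Adjacent x y = toℕ x ≡ suc (toℕ y) ⊎ toℕ y ≡ suc (toℕ x)

adjacent? : (x y : Lane N) → Dec (Adjacent x y)
adjacent? x y = (toℕ x ≟ suc (toℕ y)) ⊎-dec (toℕ y ≟ suc (toℕ x))

Adjacent⇒≢ : {x y : Lane N} → Adjacent x y → x ≢ y
Adjacent⇒≢ (inj₁ x≡1+x) refl = 1+n≢n (sym x≡1+x)
Adjacent⇒≢ (inj₂ y≡1+y) refl = 1+n≢n (sym y≡1+y)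

does-∨≡true⇒⊎ : {A B : Set} (a? : Dec A) (b? : Dec B) → does a? ∨ does b? ≡ true → A ⊎ B
does-∨≡true⇒⊎ (yes a) _       _ = inj₁ a
does-∨≡true⇒⊎ (no _)  (yes b) _ = inj₂ b
does-∨≡true⇒⊎ (no _)  (no _)  ()

∈adj⇒Adjacent : {x y : Lane N} → x ∈ adj y → Adjacent x y
∈adj⇒Adjacent {x = x} {y} x∈adj = does-∨≡true⇒⊎ (toℕ x ≟ suc (toℕ y)) (toℕ y ≟ suc (toℕ x))
  (trans (sym (lookup∘tabulate (λ l → does (toℕ l ≟ suc (toℕ y)) ∨ does (toℕ y ≟ suc (toℕ l))) x))
         ([]=⇒lookup x∈adj))

⁅x⁆∩adj≢⊥⇒Adjacent : {x y : Lane N} → ¬ (⁅ x ⁆ ∩ adj y ≡ ⊥) → Adjacent x y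
⁅x⁆∩adj≢⊥⇒Adjacent {x = x} {y} ⁅x⁆∩adj≢⊥ with adjacent? x y
... | yes x∼y = x∼y
... | no ¬x∼y = contradiction (Empty-unique λ (z , z∈⁅x⁆∩adj) →
  let z∈⁅x⁆ , z∈adj = x∈p∩q⁻ ⁅ x ⁆ (adj y) z∈⁅x⁆∩adj
  in ¬x∼y (subst (λ w → Adjacent w y) (x∈⁅y⁆⇒x≡y x z∈⁅x⁆) (∈adj⇒Adjacent z∈adj))) ⁅x⁆∩adj≢⊥

Consecutive : Lanes N → Set
Consecutive ls = ∃[ n ] ∃[ m ] (toℕ m ≡ suc (toℕ n) × ls ≡ ⁅ n ⁆ ∪ ⁅ m ⁆)

Adjacent⇒Consecutive : {x y : Lane N} → Adjacent x y → Consecutive (⁅ x ⁆ ∪ ⁅ y ⁆)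
Adjacent⇒Consecutive {x = x} {y} (inj₁ x≡1+y) = y , x , x≡1+y , ∪-comm ⁅ x ⁆ ⁅ y ⁆
Adjacent⇒Consecutive {x = x} {y} (inj₂ y≡1+x) = x , y , y≡1+x , refl

record SaneLanes (rs cs : Lanes N) : Set where
  field
    s1 : rs ∩ cs ≡ ⊥
    s2 : 1≤ ∣ rs ∣ ≤2
    s3 : ∣ cs ∣ ≤ 1
    s4 : 1≤ ∣ rs ∣ + ∣ cs ∣ ≤2
    s5 : ¬ (cs ≡ ⊥) → Consecutive (rs ∪ cs)

sane-lanes : {T : Structure N R} → Sane T → ∀ C → SaneLanes (res T C) (clm T C)
sane-lanes S C = record
  { s1 = Sane.s1 S C ; s2 = Sane.s2 S C ; s3 = Sane.s3 S C ; s4 = Sane.s4 S C ; s5 = Sane.s5 S C }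

unclaimed-sane : {rs : Lanes N} → 1≤ ∣ rs ∣ ≤2 → SaneLanes rs ⊥
unclaimed-sane {N} {rs} 1≤∣rs∣≤2 = record
  { s1 = ∩-zeroʳ rs
  ; s2 = 1≤∣rs∣≤2
  ; s3 = subst (_≤ 1) (sym (∣⊥∣≡0 (suc N))) z≤n
  ; s4 = subst 1≤_≤2 (sym (trans (cong (∣ rs ∣ +_) (∣⊥∣≡0 (suc N))) (+-identityʳ ∣ rs ∣))) 1≤∣rs∣≤2
  ; s5 = λ ⊥≢⊥ → contradiction refl ⊥≢⊥
  }

1≤∣⁅x⁆∣≤2 : (x : Fin n) → 1≤ ∣ ⁅ x ⁆ ∣ ≤2
1≤∣⁅x⁆∣≤2 x rewrite ∣⁅x⁆∣≡1 x = s≤s z≤n , s≤s z≤n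

claim-sane : {rs : Lanes N} {x : Lane N} → ∣ rs ∣ ≡ 1 → ¬ (rs ∩ adj x ≡ ⊥) → SaneLanes rs ⁅ x ⁆
claim-sane {rs = rs} {x} ∣rs∣≡1 rs∩adj≢⊥ with ∣p∣≡1⇒p≡⁅x⁆ rs ∣rs∣≡1
... | y , refl = record
  { s1 = ⁅x⁆∩⁅y⁆≡⊥ (Adjacent⇒≢ y∼x)
  ; s2 = 1≤∣⁅x⁆∣≤2 y
  ; s3 = subst (_≤ 1) (sym (∣⁅x⁆∣≡1 x)) (s≤s z≤n)
  ; s4 = subst 1≤_≤2 (sym (cong₂ _+_ (∣⁅x⁆∣≡1 y) (∣⁅x⁆∣≡1 x))) (s≤s z≤n , s≤s (s≤s z≤n))
  ; s5 = λ _ → Adjacent⇒Consecutive y∼x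
  }
  where
  y∼x : Adjacent y x
  y∼x = ⁅x⁆∩adj≢⊥⇒Adjacent rs∩adj≢⊥

reserve-sane : {rs cs : Lanes N} → SaneLanes rs cs → SaneLanes (rs ∪ cs) ⊥
reserve-sane {rs = rs} {cs} S = unclaimed-sane
  (subst 1≤_≤2 (sym (p∩q≡⊥⇒∣p∪q∣≡∣p∣+∣q∣ rs cs (SaneLanes.s1 S))) (SaneLanes.s4 S))

∣rs∣≡2⇒unclaimed : {rs cs : Lanes N} → SaneLanes rs cs → ∣ rs ∣ ≡ 2 → cs ≡ ⊥
∣rs∣≡2⇒unclaimed {cs = cs} S ∣rs∣≡2 = ∣p∣≡0⇒p≡⊥ cs (n≤0⇒n≡0 (+-cancelˡ-≤ 2 ∣ cs ∣ 0
  (subst (λ k → k + ∣ cs ∣ ≤ 2) ∣rs∣≡2 (proj₂ (SaneLanes.s4 S)))))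

⊕-≡ : {A : Set} (f : Car → A) (C : Car) (y : A) → (f ⊕[ C ↦ y ]) C ≡ y
⊕-≡ f C y = cong (if_then y else f C) (dec-true (C ≟ C) refl)

⊕-≢ : {A : Set} (f : Car → A) {C C' : Car} (y : A) → C' ≢ C → (f ⊕[ C ↦ y ]) C' ≡ f C'
⊕-≢ f {C} {C'} y C'≢C = cong (if_then y else f C') (dec-false (C' ≟ C) C'≢C)

≗-override : {A : Set} {g f : Car → A} {C : Car} {y : A} → g ≗ f → f C ≡ y → g ≗ (f ⊕[ C ↦ y ])
≗-override {f = f} {C} {y} g≗f fC≡y C' with C' ≟ C
... | yes refl = trans (g≗f C) (trans fC≡y (sym (⊕-≡ f C y)))
... | no C'≢C  = trans (g≗f C') (sym (⊕-≢ f y C'≢C))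

sane-override : {T T' : Structure N R} {C : Car} {rs cs : Lanes N} →
  Sane T → SaneLanes rs cs →
  res T' ≗ (res T ⊕[ C ↦ rs ]) → clm T' ≗ (clm T ⊕[ C ↦ cs ]) → Sane T'
sane-override {T = T} {T'} {C} {rs} {cs} S Sᶜ res≗ clm≗ = record
  { s1 = λ C' → SaneLanes.s1 (lanes C')
  ; s2 = λ C' → SaneLanes.s2 (lanes C')
  ; s3 = λ C' → SaneLanes.s3 (lanes C')
  ; s4 = λ C' → SaneLanes.s4 (lanes C')
  ; s5 = λ C' → SaneLanes.s5 (lanes C')
  ; s6 = C ∷ proj₁ (Sane.s6 S) , listed
  }
  where
  unchanged : ∀ {C'} → C' ≢ C → res T' C' ≡ res T C' × clm T' C' ≡ clm T C'
  unchanged C'≢C = trans (res≗ _) (⊕-≢ (res T) rs C'≢C) , trans (clm≗ _) (⊕-≢ (clm T) cs C'≢C)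

  lanes : ∀ C' → SaneLanes (res T' C') (clm T' C')
  lanes C' with C' ≟ C
  ... | yes refl = subst₂ SaneLanes (sym (trans (res≗ C) (⊕-≡ (res T) C rs)))
                                    (sym (trans (clm≗ C) (⊕-≡ (clm T) C cs))) Sᶜ
  ... | no C'≢C with unchanged C'≢C
  ...   | res≡ , clm≡ = subst₂ SaneLanes (sym res≡) (sym clm≡) (sane-lanes S C')

  listed : ∀ C' → (∣ res T' C' ∣ ≡ 2 ⊎ ∣ clm T' C' ∣ ≡ 1) → C' ∈ₗ C ∷ proj₁ (Sane.s6 S)
  listed C' busy with C' ≟ C
  ... | yes C'≡C = here C'≡C
  ... | no C'≢C with unchanged C'≢C
  ...   | res≡ , clm≡ = there (proj₂ (Sane.s6 S) C'
    (subst₂ (λ rs' cs' → ∣ rs' ∣ ≡ 2 ⊎ ∣ cs' ∣ ≡ 1) res≡ clm≡ busy))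

-- Any car will do: it is overridden with its own lanes.
sane-resp : {T T' : Structure N R} → Sane T → res T' ≗ res T → clm T' ≗ clm T → Sane T'
sane-resp S res≗ clm≗ =
  sane-override {C = 0} S (sane-lanes S 0) (≗-override res≗ refl) (≗-override clm≗ refl)

lemma2p3 : (N : ℕ) → 1 ≤ N → (R : Set) (_+ᴿ_ _*ᴿ_ : R → R → R) (half : R) →
    (T T' : Structure N R) (α : Action N R) →
    Sane T → Step _+ᴿ_ _*ᴿ_ half T α T' → Sane T'
lemma2p3 _ _ _ _ _ _ _ _ (c C n) S (res≗ , _ , _ , _ , _ , ∣res∣≡1 , res∩adj≢⊥ , clm≗) =
  sane-override S (claim-sane ∣res∣≡1 res∩adj≢⊥) (≗-override res≗ refl) clm≗
lemma2p3 _ _ _ _ _ _ _ _ (wdc C) S (res≗ , _ , _ , _ , clm≗) =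
  sane-override S (unclaimed-sane (Sane.s2 S C)) (≗-override res≗ refl) clm≗
lemma2p3 _ _ _ _ _ _ _ _ (r C) S (_ , _ , _ , clm≗ , res≗) =
  sane-override S (reserve-sane (sane-lanes S C)) res≗ clm≗
lemma2p3 _ _ _ _ _ _ _ _ (wdr C n) S (clm≗ , _ , _ , _ , res≗ , _ , ∣res∣≡2) =
  sane-override S (unclaimed-sane (1≤∣⁅x⁆∣≤2 n)) res≗
    (≗-override clm≗ (∣rs∣≡2⇒unclaimed (sane-lanes S C) ∣res∣≡2))
lemma2p3 _ _ _ _ _ _ _ _ (time t) S (res≗ , clm≗ , _) = sane-resp S res≗ clm≗
lemma2p3 _ _ _ _ _ _ _ _ (accl C a) S (res≗ , clm≗ , _) = sane-resp S res≗ clm≗
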